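{- Let the sequence $(b_i)_{i\ge 0}$ be defined by $$b_0=0,\quad b_1=12,\quad b_2=420,\quad b_{i+3}=35b_{i+2}-35b_{i+1}+b_i\ (i\ge 0).$$ Then for every positive integer $i$, the triple $\{4,b_i,b_{i+1}\}$ is a $D(n)$-set for each of $n=n_1,n_2,n_3$, where \begin{align*} n_1&=1,\\ n_2&=4+b_i+b_{i+1},\\ n_3&=\tfrac14(4+b_i+b_{i+1})^2-4b_i-4b_{i+1}-b_ib_{i+1}. \end{align*}
   Context: For a nonzero integer $n$, a $D(n)$-set is a set of distinct nonzero integers $\{a_1,\dots,a_m\}$ such that $a_ia_j+n$ is a perfect square for all $1\le i<j\le m$. -}

module Defs where

open import Data.Nat using (ℕ; zero; suc)
open import Data.Integer using (ℤ; +_; _+_; _-_; _*_)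
open import Data.Integer.DivMod using (_/_)
open import Data.Product using (∃; _×_)
open import Relation.Binary.PropositionalEquality using (_≡_; _≢_)

b : ℕ → ℤ
b zero = + 0
b (suc zero) = + 12
b (suc (suc zero)) = + 420
b (suc (suc (suc i))) = + 35 * b (suc (suc i)) - + 35 * b (suc i) + b i

IsSquare : ℤ → Set
IsSquare x = ∃ λ (y : ℤ) → y * y ≡ x

-- {a₁, a₂, a₃} is a D(n)-set: distinct nonzero integers with
-- aᵢ aⱼ + n a perfect square for all i < j.
-- (The paper requires n to be nonzero.)
IsDTriple : ℤ → ℤ → ℤ → ℤ → Set
IsDTriple n a₁ a₂ a₃ =
  (a₁ ≢ + 0 × a₂ ≢ + 0 × a₃ ≢ + 0) ×
  (a₁ ≢ a₂ × a₁ ≢ a₃ × a₂ ≢ a₃) ×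
  (IsSquare (a₁ * a₂ + n) × IsSquare (a₁ * a₃ + n) × IsSquare (a₂ * a₃ + n))

n₁ : ℕ → ℤ
n₁ i = + 1

n₂ : ℕ → ℤ
n₂ i = + 4 + b i + b (suc i)

-- n₃ = (1/4)(4 + bᵢ + b_{i+1})² - 4bᵢ - 4b_{i+1} - bᵢ b_{i+1};
-- the division by 4 is exact (all bᵢ are divisible by 4), so integer
-- division computes it exactly.
n₃ : ℕ → ℤ
n₃ i = (n₂ i * n₂ i) / + 4 - + 4 * b i - + 4 * b (suc i) - b i * b (suc i)

{-# OPTIONS --safe #-}
-- bᵢ = pᵢ (pᵢ + 1), where (pᵢ, pᵢ + 1, hᵢ) runs through the Pythagorean
-- triples with consecutive legs, (0, 1, 1), (3, 4, 5), (20, 21, 29), …,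
-- generated by (p, h) ↦ (3p + 2h + 1, 4p + 3h + 2): this map preserves
-- h² - p² - (p + 1)², and p(p + 1) then obeys the recurrence of b.
-- For consecutive terms B = p(p + 1), C = q(q + 1), q = 3p + 2h + 1, every
-- square required for n₁ and n₂ has a root polynomial in p and h, whose
-- square differs from the target by a multiple of h² - p² - (p + 1)².
-- For n₃ nothing about B and C is needed beyond 4 + B + C = 2m: then
-- 4B + n₃, 4C + n₃ and BC + n₃ are (m - C)², (m - B)² and (m - 4)².
module Submission where

open import Defs
open import Data.Nat as ℕ using (ℕ; zero; suc; z≤n; s≤s; z<s)
import Data.Nat.Properties as ℕ
open import Data.Nat.DivMod using (m*n/n≡m)
open import Data.Integer using (ℤ; +_; -[1+_]; _+_; _-_; -_; _*_; _/_; _<_; +<+)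
import Data.Integer.Properties as ℤ
open import Data.Integer.DivMod using (div-pos-is-/ℕ)
open import Data.Integer.Tactic.RingSolver using (solve-∀)
open import Data.Product using (_×_; ∃; _,_; proj₁; proj₂)
open import Relation.Binary.PropositionalEquality
open ≡-Reasoning

pronic : ℤ → ℤ
pronic x = x * (x + + 1)

SquareProducts : ℤ → ℤ → ℤ → ℤ → Set
SquareProducts n a₁ a₂ a₃ =
  IsSquare (a₁ * a₂ + n) × IsSquare (a₁ * a₃ + n) × IsSquare (a₂ * a₃ + n)

IsDTriple-increasing : ∀ {n a₁ a₂ a₃} → + 0 < a₁ → a₁ < a₂ → a₂ < a₃ →
                       SquareProducts n a₁ a₂ a₃ → IsDTriple n a₁ a₂ a₃
IsDTriple-increasing {a₂ = a₂} {a₃ = a₃} 0<a₁ a₁<a₂ a₂<a₃ squares =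
    (≢-sym (ℤ.<⇒≢ 0<a₁) , ≢-sym (ℤ.<⇒≢ 0<a₂) , ≢-sym (ℤ.<⇒≢ 0<a₃))
  , (ℤ.<⇒≢ a₁<a₂ , ℤ.<⇒≢ (ℤ.<-trans a₁<a₂ a₂<a₃) , ℤ.<⇒≢ a₂<a₃)
  , squares
  where
  0<a₂ : + 0 < a₂
  0<a₂ = ℤ.<-trans 0<a₁ a₁<a₂
  0<a₃ : + 0 < a₃
  0<a₃ = ℤ.<-trans 0<a₂ a₂<a₃

drop-vanishing-multiple : ∀ {x y r : ℤ} (k : ℤ) → r ≡ + 0 → x ≡ y + k * r → x ≡ y
drop-vanishing-multiple {x} {y} k refl x≡y+k*0 = begin
  x           ≡⟨ x≡y+k*0 ⟩
  y + k * + 0 ≡⟨ cong (_+_ y) (ℤ.*-zeroʳ k) ⟩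
  y + + 0     ≡⟨ ℤ.+-identityʳ y ⟩
  y           ∎

square-nonNeg : ∀ m → ∃ λ k → m * m ≡ + k
square-nonNeg (+ k)    = k ℕ.* k , sym (ℤ.pos-* k k)
square-nonNeg -[1+ k ] = suc k ℕ.* suc k , refl

pos-*-/ : ∀ m n .{{_ : ℕ.NonZero n}} → (+ m * + n) / + n ≡ + m
pos-*-/ m n = begin
  (+ m * + n) / + n ≡⟨ cong (_/ + n) (sym (ℤ.pos-* m n)) ⟩
  + (m ℕ.* n) / + n ≡⟨ div-pos-is-/ℕ (+ (m ℕ.* n)) n ⟩
  + (m ℕ.* n ℕ./ n) ≡⟨ cong +_ (m*n/n≡m m n) ⟩
  + m               ∎

-- Going through a natural number avoids the rounding cases of ℤ division
-- on negative dividends.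
quarter-of-even-square : ∀ m → ((+ 2 * m) * (+ 2 * m)) / + 4 ≡ m * m
quarter-of-even-square m = begin
  ((+ 2 * m) * (+ 2 * m)) / + 4 ≡⟨ cong (_/ + 4) (identity m) ⟩
  (m * m * + 4) / + 4           ≡⟨ cong (λ s → (s * + 4) / + 4) m*m≡k ⟩
  (+ k * + 4) / + 4             ≡⟨ pos-*-/ k 4 ⟩
  + k                           ≡⟨ m*m≡k ⟨
  m * m                         ∎
  where
  identity : ∀ m → (+ 2 * m) * (+ 2 * m) ≡ m * m * + 4
  identity = solve-∀
  k : ℕ
  k = proj₁ (square-nonNeg m)
  m*m≡k : m * m ≡ + k
  m*m≡k = proj₂ (square-nonNeg m)

squareProducts-half-sum : ∀ a B C m → a + B + C ≡ + 2 * m →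
  SquareProducts (((a + B + C) * (a + B + C)) / + 4 - a * B - a * C - B * C) a B C
squareProducts-half-sum a B C m s≡2m =
  subst (λ n → SquareProducts n a B C) (sym n≡n′) (square₁ , square₂ , square₃)
  where
  n′ : ℤ
  n′ = m * m - a * B - a * C - B * C
  n≡n′ : ((a + B + C) * (a + B + C)) / + 4 - a * B - a * C - B * C ≡ n′
  n≡n′ = cong (λ t → t - a * B - a * C - B * C)
              (trans (cong (λ s → (s * s) / + 4) s≡2m) (quarter-of-even-square m))
  r≡0 : a + B + C - + 2 * m ≡ + 0
  r≡0 = ℤ.i≡j⇒i-j≡0 s≡2m
  square₁ : IsSquare (a * B + n′)
  square₁ = m - C , drop-vanishing-multiple C r≡0 (identity a B C m)
    where
    identity : ∀ a B C m → (m - C) * (m - C) ≡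
      a * B + (m * m - a * B - a * C - B * C) + C * (a + B + C - + 2 * m)
    identity = solve-∀
  square₂ : IsSquare (a * C + n′)
  square₂ = m - B , drop-vanishing-multiple B r≡0 (identity a B C m)
    where
    identity : ∀ a B C m → (m - B) * (m - B) ≡
      a * C + (m * m - a * B - a * C - B * C) + B * (a + B + C - + 2 * m)
    identity = solve-∀
  square₃ : IsSquare (B * C + n′)
  square₃ = m - a , drop-vanishing-multiple a r≡0 (identity a B C m)
    where
    identity : ∀ a B C m → (m - a) * (m - a) ≡
      B * C + (m * m - a * B - a * C - B * C) + a * (a + B + C - + 2 * m)
    identity = solve-∀

pythagoreanDefect : ℤ → ℤ → ℤ
pythagoreanDefect p h = h * h - (p * p + (p + + 1) * (p + + 1))

nextLeg : ℤ → ℤ → ℤ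
nextLeg p h = + 3 * p + + 2 * h + + 1

nextHypotenuse : ℤ → ℤ → ℤ
nextHypotenuse p h = + 4 * p + + 3 * h + + 2

pythagoreanDefect-next : ∀ p h →
  pythagoreanDefect (nextLeg p h) (nextHypotenuse p h) ≡ pythagoreanDefect p h
pythagoreanDefect-next = identity
  where
  identity : ∀ p h → let q = + 3 * p + + 2 * h + + 1; k = + 4 * p + + 3 * h + + 2 in
    k * k - (q * q + (q + + 1) * (q + + 1)) ≡ h * h - (p * p + (p + + 1) * (p + + 1))
  identity = solve-∀

four-pronic-plus-one : ∀ x → IsSquare (+ 4 * pronic x + + 1)
four-pronic-plus-one x = + 2 * x + + 1 , identity x
  where
  identity : ∀ x → (+ 2 * x + + 1) * (+ 2 * x + + 1) ≡ + 4 * (x * (x + + 1)) + + 1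
  identity = solve-∀

-- The root of BC + 1 is pq + (p + q - 1) / 2, and p + q - 1 = 4p + 2h.
pythagorean-squareProducts-1 : ∀ p h {B C} → pythagoreanDefect p h ≡ + 0 →
  B ≡ pronic p → C ≡ pronic (nextLeg p h) → SquareProducts (+ 1) (+ 4) B C
pythagorean-squareProducts-1 p h δ≡0 refl refl =
    four-pronic-plus-one p
  , four-pronic-plus-one (nextLeg p h)
  , p * nextLeg p h + + 2 * p + h , drop-vanishing-multiple (+ 1) δ≡0 (identity p h)
  where
  identity : ∀ p h → let q = + 3 * p + + 2 * h + + 1 in
    (p * q + + 2 * p + h) * (p * q + + 2 * p + h) ≡
    p * (p + + 1) * (q * (q + + 1)) + + 1 + + 1 * (h * h - (p * p + (p + + 1) * (p + + 1)))
  identity = solve-∀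

pythagorean-squareProducts-sum : ∀ p h {B C} → pythagoreanDefect p h ≡ + 0 →
  B ≡ pronic p → C ≡ pronic (nextLeg p h) → SquareProducts (+ 4 + B + C) (+ 4) B C
pythagorean-squareProducts-sum p h δ≡0 refl refl =
    (+ 2 * p + + 3 * h + + 1 , drop-vanishing-multiple (+ 5) δ≡0 (identity₁ p h))
  , (+ 6 * p + + 5 * h + + 3 , drop-vanishing-multiple (+ 5) δ≡0 (identity₂ p h))
  , (p * nextLeg p h + + 2 * p + h + + 3 , drop-vanishing-multiple (- + 3) δ≡0 (identity₃ p h))
  where
  identity₁ : ∀ p h → let q = + 3 * p + + 2 * h + + 1 in
    (+ 2 * p + + 3 * h + + 1) * (+ 2 * p + + 3 * h + + 1) ≡
    + 4 * (p * (p + + 1)) + (+ 4 + p * (p + + 1) + q * (q + + 1))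
      + + 5 * (h * h - (p * p + (p + + 1) * (p + + 1)))
  identity₁ = solve-∀
  identity₂ : ∀ p h → let q = + 3 * p + + 2 * h + + 1 in
    (+ 6 * p + + 5 * h + + 3) * (+ 6 * p + + 5 * h + + 3) ≡
    + 4 * (q * (q + + 1)) + (+ 4 + p * (p + + 1) + q * (q + + 1))
      + + 5 * (h * h - (p * p + (p + + 1) * (p + + 1)))
  identity₂ = solve-∀
  identity₃ : ∀ p h → let q = + 3 * p + + 2 * h + + 1 in
    (p * q + + 2 * p + h + + 3) * (p * q + + 2 * p + h + + 3) ≡
    p * (p + + 1) * (q * (q + + 1)) + (+ 4 + p * (p + + 1) + q * (q + + 1))
      + - + 3 * (h * h - (p * p + (p + + 1) * (p + + 1)))
  identity₃ = solve-∀

pythagorean-sum-even : ∀ p h {B C} → pythagoreanDefect p h ≡ + 0 →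
  B ≡ pronic p → C ≡ pronic (nextLeg p h) →
  + 4 + B + C ≡ + 2 * (+ 9 * p * p + + 6 * p * h + + 9 * p + + 3 * h + + 5)
pythagorean-sum-even p h δ≡0 refl refl = drop-vanishing-multiple (+ 4) δ≡0 (identity p h)
  where
  identity : ∀ p h → let q = + 3 * p + + 2 * h + + 1 in
    + 4 + p * (p + + 1) + q * (q + + 1) ≡
    + 2 * (+ 9 * p * p + + 6 * p * h + + 9 * p + + 3 * h + + 5)
      + + 4 * (h * h - (p * p + (p + + 1) * (p + + 1)))
  identity = solve-∀

leg : ℕ → ℕ
hypotenuse : ℕ → ℕ
leg zero           = 0
leg (suc i)        = 3 ℕ.* leg i ℕ.+ 2 ℕ.* hypotenuse i ℕ.+ 1
hypotenuse zero    = 1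
hypotenuse (suc i) = 4 ℕ.* leg i ℕ.+ 3 ℕ.* hypotenuse i ℕ.+ 2

pos-linear : ∀ a c e x y → + (a ℕ.* x ℕ.+ c ℕ.* y ℕ.+ e) ≡ + a * + x + + c * + y + + e
pos-linear a c e x y = cong₂ (λ u v → u + v + + e) (ℤ.pos-* a x) (ℤ.pos-* c y)

leg-suc : ∀ i → + leg (suc i) ≡ nextLeg (+ leg i) (+ hypotenuse i)
leg-suc i = pos-linear 3 2 1 (leg i) (hypotenuse i)

hypotenuse-suc : ∀ i → + hypotenuse (suc i) ≡ nextHypotenuse (+ leg i) (+ hypotenuse i)
hypotenuse-suc i = pos-linear 4 3 2 (leg i) (hypotenuse i)

pythagoreanDefect-leg : ∀ i → pythagoreanDefect (+ leg i) (+ hypotenuse i) ≡ + 0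
pythagoreanDefect-leg zero    = refl
pythagoreanDefect-leg (suc i) = begin
  pythagoreanDefect (+ leg (suc i)) (+ hypotenuse (suc i))
    ≡⟨ cong₂ pythagoreanDefect (leg-suc i) (hypotenuse-suc i) ⟩
  pythagoreanDefect (nextLeg p h) (nextHypotenuse p h)
    ≡⟨ pythagoreanDefect-next p h ⟩
  pythagoreanDefect p h
    ≡⟨ pythagoreanDefect-leg i ⟩
  + 0 ∎
  where
  p h : ℤ
  p = + leg i
  h = + hypotenuse i

leg-recurrence : ∀ i → + leg (suc (suc i)) ≡ + 6 * + leg (suc i) - + leg i + + 2
leg-recurrence i = begin
  + leg (suc (suc i))
    ≡⟨ leg-suc (suc i) ⟩
  nextLeg (+ leg (suc i)) (+ hypotenuse (suc i))
    ≡⟨ cong₂ nextLeg (leg-suc i) (hypotenuse-suc i) ⟩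
  nextLeg (nextLeg p h) (nextHypotenuse p h)
    ≡⟨ identity p h ⟩
  + 6 * nextLeg p h - p + + 2
    ≡⟨ cong (λ q → + 6 * q - p + + 2) (leg-suc i) ⟨
  + 6 * + leg (suc i) - p + + 2 ∎
  where
  p h : ℤ
  p = + leg i
  h = + hypotenuse i
  identity : ∀ p h → let q = + 3 * p + + 2 * h + + 1; k = + 4 * p + + 3 * h + + 2 in
    + 3 * q + + 2 * k + + 1 ≡ + 6 * q - p + + 2
  identity = solve-∀

pronic-recurrence : (x : ℕ → ℤ) → (∀ i → x (suc (suc i)) ≡ + 6 * x (suc i) - x i + + 2) →
  ∀ i → pronic (x (suc (suc (suc i)))) ≡
        + 35 * pronic (x (suc (suc i))) - + 35 * pronic (x (suc i)) + pronic (x i)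
pronic-recurrence x rec i rewrite rec (suc i) | rec i = identity (x i) (x (suc i))
  where
  identity : ∀ u v → let w = + 6 * v - u + + 2; z = + 6 * w - v + + 2 in
    z * (z + + 1) ≡ + 35 * (w * (w + + 1)) - + 35 * (v * (v + + 1)) + u * (u + + 1)
  identity = solve-∀

b-unique : (c : ℕ → ℤ) → c 0 ≡ + 0 → c 1 ≡ + 12 → c 2 ≡ + 420 →
  (∀ i → c (suc (suc (suc i))) ≡ + 35 * c (suc (suc i)) - + 35 * c (suc i) + c i) →
  ∀ i → b i ≡ c i
b-unique c c₀ c₁ c₂ rec i = proj₁ (agree i)
  where
  agree : ∀ i → b i ≡ c i × b (suc i) ≡ c (suc i) × b (suc (suc i)) ≡ c (suc (suc i))
  agree zero = sym c₀ , sym c₁ , sym c₂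
  agree (suc i) with agree i
  ... | e₀ , e₁ , e₂ = e₁ , e₂ ,
    trans (cong₂ _+_ (cong₂ (λ u v → + 35 * u - + 35 * v) e₂ e₁) e₀) (sym (rec i))

b-pronic-leg : ∀ i → b i ≡ pronic (+ leg i)
b-pronic-leg = b-unique (λ i → pronic (+ leg i)) refl refl refl
                        (pronic-recurrence (λ i → + leg i) leg-recurrence)

leg-increasing : ∀ i → leg i ℕ.< leg (suc i)
leg-increasing i = ℕ.≤-<-trans (ℕ.≤-trans (ℕ.m≤m+n (leg i) _) (ℕ.m≤m+n (3 ℕ.* leg i) _))
                               (ℕ.m<m+n _ z<s)

three≤leg-suc : ∀ i → 3 ℕ.≤ leg (suc i)
three≤leg-suc zero    = ℕ.≤-refl
three≤leg-suc (suc i) = ℕ.<⇒≤ (ℕ.≤-<-trans (three≤leg-suc i) (leg-increasing (suc i)))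

b-pos : ∀ i → b i ≡ + (leg i ℕ.* (leg i ℕ.+ 1))
b-pos i = trans (b-pronic-leg i) (sym (ℤ.pos-* (leg i) (leg i ℕ.+ 1)))

four<b-suc : ∀ i → + 4 < b (suc i)
four<b-suc i = subst (+ 4 <_) (sym (b-pos (suc i))) (+<+ (ℕ.<-≤-trans 4<12 12≤b))
  where
  4<12 : 4 ℕ.< 12
  4<12 = s≤s (s≤s (s≤s (s≤s (s≤s z≤n))))
  12≤b : 12 ℕ.≤ leg (suc i) ℕ.* (leg (suc i) ℕ.+ 1)
  12≤b = ℕ.*-mono-≤ (three≤leg-suc i) (ℕ.+-monoˡ-≤ 1 (three≤leg-suc i))

b-increasing : ∀ i → b i < b (suc i)
b-increasing i = subst₂ _<_ (sym (b-pos i)) (sym (b-pos (suc i)))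
  (+<+ (ℕ.*-mono-< (leg-increasing i) (ℕ.+-monoˡ-< 1 (leg-increasing i))))

corollary4 : (i : ℕ) → IsDTriple (n₁ (suc i)) (+ 4) (b (suc i)) (b (suc (suc i)))
    × IsDTriple (n₂ (suc i)) (+ 4) (b (suc i)) (b (suc (suc i)))
    × IsDTriple (n₃ (suc i)) (+ 4) (b (suc i)) (b (suc (suc i)))
corollary4 i =
    dTriple (pythagorean-squareProducts-1 p h δ≡0 B≡ C≡)
  , dTriple (pythagorean-squareProducts-sum p h δ≡0 B≡ C≡)
  , dTriple (squareProducts-half-sum (+ 4) B C _ (pythagorean-sum-even p h δ≡0 B≡ C≡))
  where
  B C p h : ℤ
  B = b (suc i)
  C = b (suc (suc i))
  p = + leg (suc i)
  h = + hypotenuse (suc i)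
  δ≡0 : pythagoreanDefect p h ≡ + 0
  δ≡0 = pythagoreanDefect-leg (suc i)
  B≡ : B ≡ pronic p
  B≡ = b-pronic-leg (suc i)
  C≡ : C ≡ pronic (nextLeg p h)
  C≡ = trans (b-pronic-leg (suc (suc i))) (cong pronic (leg-suc (suc i)))
  dTriple : ∀ {n} → SquareProducts n (+ 4) B C → IsDTriple n (+ 4) B C
  dTriple = IsDTriple-increasing (+<+ z<s) (four<b-suc i) (b-increasing (suc i))
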